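{- Let $G=(V,E)$ be a finite connected directed graph with no loops and such that for distinct vertices $a,b$ at most one of $(a,b),(b,a)$ lies in $E$. Let $f$ be a real function on $V$ and $A$ a real function on $E$ with $\nabla\cdot A=f$. Let $T\subseteq E$ form a spanning tree of the underlying undirected graph, $s$ a leaf of $T$, $u$ the function on $V$ induced from $A$ by $T$ and $s$, and $T'=E\setminus T$. Then $$\mathrm{gap}(A)=\sum_{e\in T'}(A,C_e)^2.$$
   Context: For real functions on a finite set, $(f,g)=\sum f(x)g(x)$ and $\|f\|^2=(f,f)$. The gradient is $\nabla u(a,b)=u(b)-u(a)$; the divergence is $\nabla\cdot A(a)=\sum_{(b,a)\in E}A(b,a)-\sum_{(a,b)\in E}A(a,b)$. The function $u$ induced from $A$ by $T$ and $s$: $u(s)=0$ and $u(t)$ is the sum of $A$ over the edges of the tree path from $s$ to $t$, each with a plus sign if directed toward $t$ along the path and a minus sign otherwise. $\mathrm{gap}(A)=\|A\|^2-\bigl(2(u,f)-(\nabla u,\nabla u)\bigr)$. For $e\in T'$, $C_e$ is the tree cycle function: for the unique cycle $(a_1,\dots,a_k,a_1)$ of the underlying undirected graph formed by $e$ and edges of $T$, traversed so that $e$ is traversed in its own direction, $C_e(a_i,a_{i+1})=1$ if $(a_i,a_{i+1})\in E$, $C_e(a_{i+1},a_i)=-1$ if $(a_{i+1},a_i)\in E$, and $C_e=0$ on all other edges (so $C_e(e)=1$). -}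

module Defs where

open import Data.Nat using (ℕ; zero; suc)
open import Level using (_⊔_)
open import Data.Fin using (Fin; zero; suc; _≟_)
open import Data.Bool using (Bool; true; false)
open import Data.List using (List; []; _∷_)
open import Data.List.Relation.Unary.Unique.Propositional using (Unique)
open import Data.Product using (Σ; ∃; _×_; _,_)
open import Data.Sum using (_⊎_)
open import Relation.Binary.PropositionalEquality using (_≡_)
open import Relation.Nullary using (¬_; yes; no)
open import Algebra.Bundles using (CommutativeRing)

module _ {n m : ℕ} (src tgt : Fin m → Fin n) where

  NoLoops : Set
  NoLoops = ∀ e → ¬ (src e ≡ tgt e)

  -- E is a set of ordered pairs, and for distinct a b at most one of
  -- (a,b), (b,a) lies in E: two edges with the same or reversed
  -- endpoints are the same edge.
  AtMostOneOrientation : Set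
  AtMostOneOrientation = ∀ e e' →
    ((src e ≡ src e' × tgt e ≡ tgt e') ⊎ (src e ≡ tgt e' × tgt e ≡ src e')) →
    e ≡ e'

  -- a step of an undirected walk: an edge, traversed along its
  -- direction (true) or against it (false)
  Step : Set
  Step = Fin m × Bool

  data Walk (S : Fin m → Bool) : Fin n → Fin n → List Step → Set where
    nil : ∀ {a} → Walk S a a []
    fwd : ∀ {a b e p} → S e ≡ true → src e ≡ a → Walk S (tgt e) b p →
          Walk S a b ((e , true) ∷ p)
    bwd : ∀ {a b e p} → S e ≡ true → tgt e ≡ a → Walk S (src e) b p →
          Walk S a b ((e , false) ∷ p)

  verts : Fin n → List Step → List (Fin n)
  verts a [] = a ∷ []
  verts a ((e , true) ∷ p) = a ∷ verts (tgt e) p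
  verts a ((e , false) ∷ p) = a ∷ verts (src e) p

  Path : (S : Fin m → Bool) → Fin n → Fin n → List Step → Set
  Path S a b p = Walk S a b p × Unique (verts a p)

  allEdges : Fin m → Bool
  allEdges _ = true

  Connected : Set
  Connected = ∀ a b → ∃ λ p → Walk allEdges a b p

  SpanningTree : (Fin m → Bool) → Set
  SpanningTree T =
    (∀ a b → ∃ λ p → Path T a b p) ×
    (∀ a b p q → Path T a b p → Path T a b q → p ≡ q)

  Incident : Fin m → Fin n → Set
  Incident e a = src e ≡ a ⊎ tgt e ≡ a

  Leaf : (Fin m → Bool) → Fin n → Set
  Leaf T s = ∃ λ e → T e ≡ true × Incident e s ×
             (∀ e' → T e' ≡ true → Incident e' s → e' ≡ e)

module _ {c ℓ} (R : CommutativeRing c ℓ) where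
  open CommutativeRing R hiding (zero)

  ∑ : ∀ {k} → (Fin k → Carrier) → Carrier
  ∑ {zero} f = 0#
  ∑ {suc k} f = f zero + ∑ (λ i → f (suc i))

  δ : ∀ {k} → Fin k → Fin k → Carrier
  δ i j with i ≟ j
  ... | yes _ = 1#
  ... | no _ = 0#

  ⟨_,_⟩ : ∀ {k} → (Fin k → Carrier) → (Fin k → Carrier) → Carrier
  ⟨ f , g ⟩ = ∑ (λ x → f x * g x)

  sq : Carrier → Carrier
  sq x = x * x

  module _ {n m : ℕ} (src tgt : Fin m → Fin n) where

    grad : (Fin n → Carrier) → Fin m → Carrier
    grad u e = u (tgt e) - u (src e)

    div : (Fin m → Carrier) → Fin n → Carrier
    div A a = ∑ (λ e → δ (tgt e) a * A e) - ∑ (λ e → δ (src e) a * A e)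

    signedSum : (Fin m → Carrier) → List (Step src tgt) → Carrier
    signedSum A [] = 0#
    signedSum A ((e , true) ∷ p) = A e + signedSum A p
    signedSum A ((e , false) ∷ p) = - A e + signedSum A p

    -- u is the function induced from A by T and s
    -- (u(s) = 0 is the case of the empty path)
    InducedBy : (T : Fin m → Bool) → Fin n → (Fin m → Carrier) →
                (Fin n → Carrier) → Set ℓ
    InducedBy T s A u =
      ∀ t p → Path src tgt T s t p → u t ≈ signedSum A p

    pathCoef : List (Step src tgt) → Fin m → Carrier
    pathCoef [] e' = 0#
    pathCoef ((e , true) ∷ p) e' = δ e e' + pathCoef p e'
    pathCoef ((e , false) ∷ p) e' = - δ e e' + pathCoef p e'

    -- C e is the tree cycle function of e, for every e ∈ T' = E \ T:
    -- the cycle is e (from src e to tgt e) followed by the tree path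
    -- from tgt e back to src e.
    TreeCycleFunctions : (T : Fin m → Bool) → (Fin m → Fin m → Carrier) →
                         Set ℓ
    TreeCycleFunctions T C =
      ∀ e → T e ≡ false → ∀ p → Path src tgt T (tgt e) (src e) p →
      ∀ e' → C e e' ≈ δ e e' + pathCoef p e'

    gap : (Fin m → Carrier) → (Fin n → Carrier) → (Fin n → Carrier) → Carrier
    gap A u f = ⟨ A , A ⟩ - ((⟨ u , f ⟩ + ⟨ u , f ⟩) - ⟨ grad u , grad u ⟩)

-- Summation by parts turns (u, f) = (u, ∇·A) into (A, ∇u), so gap(A) = ‖A − ∇u‖².
-- Because u sums A along tree paths, ∇u agrees with A on every tree edge, so only
-- the edges e ∉ T contribute. For those, C_e is e followed by the tree path from
-- the head of e back to its tail; along that path A = ∇u telescopes, which gives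
-- (A, C_e) = A(e) − ∇u(e).

module Submission where

open import Defs
open import Algebra.Bundles using (CommutativeRing)
open import Data.Bool using (Bool; true; false; if_then_else_)
open import Data.Fin using (Fin; zero; suc; _≟_; punchIn)
open import Data.Fin.Properties using (punchInᵢ≢i)
open import Data.List using ([]; _∷_; _++_; _∷ʳ_; take; drop; length)
open import Data.List.Membership.Propositional using (_∈_; _∉_)
open import Data.List.Relation.Unary.Any using (here; there)
open import Data.List.Relation.Unary.All using ([]; _∷_)
open import Data.List.Relation.Unary.AllPairs using ([]; _∷_)
open import Data.List.Relation.Unary.Unique.Propositional using (Unique)
open import Data.List.Relation.Unary.Unique.Propositional.Properties using (take⁺; drop⁺; ++⁺)
open import Data.Nat as ℕ using (ℕ; suc)
open import Data.Product using (_×_; _,_; proj₁; ∃; ∃₂)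
open import Data.Sum using (_⊎_; inj₁; inj₂)
open import Function using (_∘_)
open import Relation.Nullary using (yes; no; contradiction)
open import Relation.Binary.PropositionalEquality as ≡ using (_≡_; _≢_; cong; subst)

module _ {n m : ℕ} {src tgt : Fin m → Fin n} where
  open import Data.List.Membership.DecPropositional (_≟_ {n}) using (_∈?_)

  walk-++ : ∀ {S a b c p q} → Walk src tgt S a b p → Walk src tgt S b c q →
            Walk src tgt S a c (p ++ q)
  walk-++ nil w = w
  walk-++ (fwd Se e≡a w) w′ = fwd Se e≡a (walk-++ w w′)
  walk-++ (bwd Se e≡a w) w′ = bwd Se e≡a (walk-++ w w′)

  walk-split : ∀ {S a b c p} → Walk src tgt S a b p → c ∈ verts src tgt a p →
               ∃₂ λ q r → p ≡ q ++ r × Walk src tgt S a c q × Walk src tgt S c b r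
  walk-split nil (here ≡.refl) = [] , [] , ≡.refl , nil , nil
  walk-split w@(fwd _ _ _) (here ≡.refl) = [] , _ , ≡.refl , nil , w
  walk-split w@(bwd _ _ _) (here ≡.refl) = [] , _ , ≡.refl , nil , w
  walk-split (fwd Se e≡a w) (there c∈p) with walk-split w c∈p
  ... | q , r , ≡.refl , wq , wr = _ ∷ q , r , ≡.refl , fwd Se e≡a wq , wr
  walk-split (bwd Se e≡a w) (there c∈p) with walk-split w c∈p
  ... | q , r , ≡.refl , wq , wr = _ ∷ q , r , ≡.refl , bwd Se e≡a wq , wr

  take-verts-++ : ∀ a p q →
                  take (suc (length p)) (verts src tgt a (p ++ q)) ≡ verts src tgt a p
  take-verts-++ a [] [] = ≡.refl
  take-verts-++ a [] ((e , true) ∷ q) = ≡.refl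
  take-verts-++ a [] ((e , false) ∷ q) = ≡.refl
  take-verts-++ a ((e , true) ∷ p) q = cong (a ∷_) (take-verts-++ (tgt e) p q)
  take-verts-++ a ((e , false) ∷ p) q = cong (a ∷_) (take-verts-++ (src e) p q)

  drop-verts-++ : ∀ {S a c p} q → Walk src tgt S a c p →
                  drop (length p) (verts src tgt a (p ++ q)) ≡ verts src tgt c q
  drop-verts-++ q nil = ≡.refl
  drop-verts-++ q (fwd _ _ w) = drop-verts-++ q w
  drop-verts-++ q (bwd _ _ w) = drop-verts-++ q w

  verts-∷ʳ : ∀ {S a b p} e → Walk src tgt S a b p →
             verts src tgt a (p ++ (e , true) ∷ []) ≡ verts src tgt a p ∷ʳ tgt e
  verts-∷ʳ e nil = ≡.refl
  verts-∷ʳ e (fwd {a = a} _ _ w) = cong (a ∷_) (verts-∷ʳ e w)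
  verts-∷ʳ e (bwd {a = a} _ _ w) = cong (a ∷_) (verts-∷ʳ e w)

  path-split : ∀ {S a b c p} → Path src tgt S a b p → c ∈ verts src tgt a p →
               ∃₂ λ q r → p ≡ q ++ r × Path src tgt S a c q × Path src tgt S c b r
  path-split (w , !p) c∈p with walk-split w c∈p
  ... | q , r , ≡.refl , wq , wr =
    q , r , ≡.refl ,
    (wq , subst Unique (take-verts-++ _ q r) (take⁺ (suc (length q)) !p)) ,
    (wr , subst Unique (drop-verts-++ r wq) (drop⁺ (length q) !p))

  path-∷ʳ : ∀ {S a b p e} → Path src tgt S a b p → S e ≡ true → src e ≡ b →
            tgt e ∉ verts src tgt a p → Path src tgt S a (tgt e) (p ++ (e , true) ∷ [])
  path-∷ʳ {e = e} (w , !p) Se e≡b tgt∉p =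
    walk-++ w (fwd Se e≡b nil) ,
    subst Unique (≡.sym (verts-∷ʳ e w))
          (++⁺ !p ([] ∷ []) λ { (tgt∈p , here ≡.refl) → tgt∉p tgt∈p })

  backward-edge-path : ∀ {S e} → NoLoops src tgt → S e ≡ true →
                       Path src tgt S (tgt e) (src e) ((e , false) ∷ [])
  backward-edge-path {e = e} noLoops Se =
    bwd Se ≡.refl nil , ((λ tgt≡src → noLoops e (≡.sym tgt≡src)) ∷ []) ∷ [] ∷ []

  tree-path-across-edge :
    ∀ {T a e p} → NoLoops src tgt → SpanningTree src tgt T → T e ≡ true →
    Path src tgt T a (src e) p →
    Path src tgt T a (tgt e) (p ++ (e , true) ∷ []) ⊎
    ∃ λ q → p ≡ q ++ (e , false) ∷ [] × Path src tgt T a (tgt e) q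
  tree-path-across-edge {a = a} {e} {p} noLoops (_ , unique) Te P
    with tgt e ∈? verts src tgt a p
  ... | no tgt∉p = inj₁ (path-∷ʳ P Te ≡.refl tgt∉p)
  ... | yes tgt∈p with path-split P tgt∈p
  ... | q , r , p≡q++r , Q , Rp =
    inj₂ (q , ≡.trans p≡q++r (cong (q ++_) r≡e) , Q)
    where
    r≡e : r ≡ (e , false) ∷ []
    r≡e = unique _ _ r _ Rp (backward-edge-path noLoops Te)

module _ {c ℓ} (R : CommutativeRing c ℓ) where
  open CommutativeRing R hiding (zero)
  open import Algebra.Properties.Ring ring
    using (-1*x≈-x; -‿distribʳ-*; x[y-z]≈xy-xz; [y-z]x≈yx-zx)
  open import Algebra.Properties.AbelianGroup +-abelianGroup using (⁻¹-anti-homo‿-; ⁻¹-∙-comm)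
  open import Algebra.Properties.Group +-group
    using (\\-leftDividesʳ; //-rightDividesˡ; //-rightDividesʳ)
  open import Algebra.Properties.CommutativeSemigroup *-commutativeSemigroup using (x∙yz≈y∙zx)
  import Algebra.Properties.Semiring.Sum semiring as Sum
  open import Relation.Binary.Reasoning.Setoid setoid

  [y-x]+[z-y]≈z-x : ∀ x y z → (y - x) + (z - y) ≈ z - x
  [y-x]+[z-y]≈z-x x y z = begin
    (y - x) + (z - y)      ≈⟨ +-comm (y - x) (z - y) ⟩
    (z - y) + (y - x)      ≈⟨ +-assoc z (- y) (y - x) ⟩
    z + (- y + (y - x))    ≈⟨ +-congˡ (\\-leftDividesʳ y (- x)) ⟩
    z - x                  ∎

  [x+y]-x≈y : ∀ x y → (x + y) - x ≈ y
  [x+y]-x≈y x y = trans (+-congʳ (+-comm x y)) (//-rightDividesʳ x y)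

  x-[x-y]≈y : ∀ x y → x - (x - y) ≈ y
  x-[x-y]≈y x y = begin
    x - (x - y)    ≈⟨ +-congˡ (⁻¹-anti-homo‿- x y) ⟩
    x + (y - x)    ≈⟨ +-comm x (y - x) ⟩
    (y - x) + x    ≈⟨ //-rightDividesˡ x y ⟩
    y              ∎

  [x-y]²≈x²-[2xy-y²] : ∀ x y → sq R (x - y) ≈ sq R x - ((x * y + x * y) - sq R y)
  [x-y]²≈x²-[2xy-y²] x y = begin
    (x - y) * (x - y)                      ≈⟨ [y-z]x≈yx-zx (x - y) x y ⟩
    x * (x - y) - y * (x - y)              ≈⟨ -cong (x[y-z]≈xy-xz x x y) (x[y-z]≈xy-xz y x y) ⟩
    (x * x - x * y) - (y * x - y * y)      ≈⟨ -cong refl (-cong (*-comm y x) refl) ⟩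
    (x * x - x * y) - (x * y - y * y)      ≈⟨ +-assoc (x * x) (- (x * y)) _ ⟩
    x * x + (- (x * y) - (x * y - y * y))  ≈⟨ +-congˡ (⁻¹-∙-comm (x * y) _) ⟩
    x * x - (x * y + (x * y - y * y))      ≈⟨ -cong refl (+-assoc (x * y) (x * y) _) ⟨
    x * x - ((x * y + x * y) - y * y)      ∎
    where
    -cong : ∀ {a b a′ b′} → a ≈ a′ → b ≈ b′ → a - b ≈ a′ - b′
    -cong a≈a′ b≈b′ = +-cong a≈a′ (-‿cong b≈b′)

  ∑≡sum : ∀ {k} (f : Fin k → Carrier) → ∑ R f ≡ Sum.sum f
  ∑≡sum {ℕ.zero} f = ≡.refl
  ∑≡sum {suc k} f = cong (f zero +_) (∑≡sum (f ∘ suc))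

  ∑-cong : ∀ {k} {f g : Fin k → Carrier} → (∀ i → f i ≈ g i) → ∑ R f ≈ ∑ R g
  ∑-cong {f = f} {g} f≈g rewrite ∑≡sum f | ∑≡sum g = Sum.sum-cong-≋ f≈g

  ∑-zero : ∀ k → ∑ R {k} (λ _ → 0#) ≈ 0#
  ∑-zero k rewrite ∑≡sum {k} (λ _ → 0#) = Sum.sum-replicate-zero k

  ∑-distrib-+ : ∀ {k} (f g : Fin k → Carrier) → ∑ R (λ i → f i + g i) ≈ ∑ R f + ∑ R g
  ∑-distrib-+ f g rewrite ∑≡sum (λ i → f i + g i) | ∑≡sum f | ∑≡sum g = Sum.∑-distrib-+ f g

  *-distribˡ-∑ : ∀ {k} x (f : Fin k → Carrier) → x * ∑ R f ≈ ∑ R (λ i → x * f i)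
  *-distribˡ-∑ x f rewrite ∑≡sum f | ∑≡sum (λ i → x * f i) = Sum.*-distribˡ-sum x f

  -‿distrib-∑ : ∀ {k} (f : Fin k → Carrier) → - ∑ R f ≈ ∑ R (λ i → - f i)
  -‿distrib-∑ f = begin
    - ∑ R f                  ≈⟨ -1*x≈-x _ ⟨
    - 1# * ∑ R f             ≈⟨ *-distribˡ-∑ (- 1#) f ⟩
    ∑ R (λ i → - 1# * f i)   ≈⟨ ∑-cong (λ i → -1*x≈-x (f i)) ⟩
    ∑ R (λ i → - f i)        ∎

  ∑-distrib-- : ∀ {k} (f g : Fin k → Carrier) → ∑ R (λ i → f i - g i) ≈ ∑ R f - ∑ R g
  ∑-distrib-- f g = trans (∑-distrib-+ f (λ i → - g i)) (+-congˡ (sym (-‿distrib-∑ g)))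

  ∑-comm : ∀ {k l} (F : Fin k → Fin l → Carrier) →
           ∑ R (λ i → ∑ R (F i)) ≈ ∑ R (λ j → ∑ R (λ i → F i j))
  ∑-comm {k} {l} F = begin
    ∑ R (λ i → ∑ R (F i))
      ≈⟨ ∑-cong (λ i → reflexive (∑≡sum (F i))) ⟩
    ∑ R (λ i → Sum.sum (F i))
      ≡⟨ ∑≡sum {k} _ ⟩
    Sum.sum (λ i → Sum.sum (F i))
      ≈⟨ Sum.∑-comm F ⟩
    Sum.sum (λ j → Sum.sum (λ i → F i j))
      ≡⟨ ∑≡sum {l} _ ⟨
    ∑ R (λ j → Sum.sum (λ i → F i j))
      ≈⟨ ∑-cong (λ j → reflexive (∑≡sum (λ i → F i j))) ⟨
    ∑ R (λ j → ∑ R (λ i → F i j)) ∎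

  δ-diag : ∀ {k} (i : Fin k) → δ R i i ≈ 1#
  δ-diag i with i ≟ i
  ... | yes _ = refl
  ... | no i≢i = contradiction ≡.refl i≢i

  δ-off : ∀ {k} {i j : Fin k} → i ≢ j → δ R i j ≈ 0#
  δ-off {i = i} {j} i≢j with i ≟ j
  ... | yes i≡j = contradiction i≡j i≢j
  ... | no _ = refl

  ∑-δ : ∀ {k} (i : Fin k) (g : Fin k → Carrier) → ∑ R (λ j → δ R i j * g j) ≈ g i
  ∑-δ {suc k} i g = begin
    ∑ R t                               ≡⟨ ∑≡sum t ⟩
    Sum.sum t                           ≈⟨ Sum.sum-remove {i = i} t ⟩
    t i + Sum.sum (t ∘ punchIn i)       ≈⟨ +-cong (*-congʳ (δ-diag i)) (Sum.sum-cong-≋ off-diagonal) ⟩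
    1# * g i + Sum.sum {k} (λ _ → 0#)   ≈⟨ +-cong (*-identityˡ (g i)) (Sum.sum-replicate-zero k) ⟩
    g i + 0#                            ≈⟨ +-identityʳ (g i) ⟩
    g i                                 ∎
    where
    t : Fin (suc k) → Carrier
    t j = δ R i j * g j
    off-diagonal : ∀ j → t (punchIn i j) ≈ 0#
    off-diagonal j = trans (*-congʳ (δ-off (punchInᵢ≢i i j ∘ ≡.sym))) (zeroˡ _)

  infix 7 _·_
  _·_ : ∀ {k} → (Fin k → Carrier) → (Fin k → Carrier) → Carrier
  x · y = ⟨_,_⟩ R x y

  module _ {k} (x : Fin k → Carrier) where

    ·-congˡ : ∀ {y z : Fin k → Carrier} → (∀ i → y i ≈ z i) → x · y ≈ x · z
    ·-congˡ y≈z = ∑-cong (λ i → *-congˡ (y≈z i))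

    ·-zeroʳ : x · (λ _ → 0#) ≈ 0#
    ·-zeroʳ = trans (∑-cong (λ i → zeroʳ (x i))) (∑-zero k)

    ·-distribˡ-+ : ∀ y z → x · (λ i → y i + z i) ≈ x · y + x · z
    ·-distribˡ-+ y z =
      trans (∑-cong (λ i → distribˡ (x i) (y i) (z i)))
            (∑-distrib-+ (λ i → x i * y i) (λ i → x i * z i))

    ·-distribˡ-- : ∀ y z → x · (λ i → y i - z i) ≈ x · y - x · z
    ·-distribˡ-- y z =
      trans (∑-cong (λ i → x[y-z]≈xy-xz (x i) (y i) (z i)))
            (∑-distrib-- (λ i → x i * y i) (λ i → x i * z i))

    ·-negʳ : ∀ y → x · (λ i → - y i) ≈ - (x · y)
    ·-negʳ y =
      trans (∑-cong (λ i → sym (-‿distribʳ-* (x i) (y i))))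
            (sym (-‿distrib-∑ (λ i → x i * y i)))

    ·-δ : ∀ i → x · δ R i ≈ x i
    ·-δ i = trans (∑-cong (λ j → *-comm (x j) (δ R i j))) (∑-δ i x)

  ·-square-expansion : ∀ {k} (x y : Fin k → Carrier) →
                       x · x - ((x · y + x · y) - y · y) ≈ ∑ R (λ i → sq R (x i - y i))
  ·-square-expansion x y = begin
    x · x - ((x · y + x · y) - y · y)
      ≈⟨ +-congˡ (-‿cong (+-congʳ (∑-distrib-+ xy xy))) ⟨
    x · x - (∑ R (λ i → xy i + xy i) - y · y)
      ≈⟨ +-congˡ (-‿cong (∑-distrib-- (λ i → xy i + xy i) yy)) ⟨
    x · x - ∑ R (λ i → (xy i + xy i) - yy i)
      ≈⟨ ∑-distrib-- (λ i → x i * x i) (λ i → (xy i + xy i) - yy i) ⟨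
    ∑ R (λ i → x i * x i - ((xy i + xy i) - yy i))
      ≈⟨ ∑-cong (λ i → [x-y]²≈x²-[2xy-y²] (x i) (y i)) ⟨
    ∑ R (λ i → sq R (x i - y i)) ∎
    where
    xy yy : Fin _ → Carrier
    xy i = x i * y i
    yy i = y i * y i

  module _ {n m : ℕ} (src tgt : Fin m → Fin n) where

    summation-by-parts : ∀ (A : Fin m → Carrier) u →
                         u · div R src tgt A ≈ A · grad R src tgt u
    summation-by-parts A u = begin
      u · div R src tgt A                ≈⟨ ·-distribˡ-- u (inflow tgt) (inflow src) ⟩
      u · inflow tgt - u · inflow src    ≈⟨ +-cong (adjoint tgt) (-‿cong (adjoint src)) ⟩
      A · (u ∘ tgt) - A · (u ∘ src)      ≈⟨ ·-distribˡ-- A (u ∘ tgt) (u ∘ src) ⟨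
      A · grad R src tgt u               ∎
      where
      inflow : (Fin m → Fin n) → Fin n → Carrier
      inflow end a = ∑ R (λ e → δ R (end e) a * A e)

      adjoint : ∀ end → u · inflow end ≈ A · (u ∘ end)
      adjoint end = begin
        ∑ R (λ a → u a * ∑ R (λ e → δ R (end e) a * A e))
          ≈⟨ ∑-cong (λ a → *-distribˡ-∑ (u a) (λ e → δ R (end e) a * A e)) ⟩
        ∑ R (λ a → ∑ R (λ e → u a * (δ R (end e) a * A e)))
          ≈⟨ ∑-comm (λ a e → u a * (δ R (end e) a * A e)) ⟩
        ∑ R (λ e → ∑ R (λ a → u a * (δ R (end e) a * A e)))
          ≈⟨ ∑-cong (λ e → ∑-cong (λ a → x∙yz≈y∙zx (u a) (δ R (end e) a) (A e))) ⟩
        ∑ R (λ e → ∑ R (λ a → δ R (end e) a * (A e * u a)))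
          ≈⟨ ∑-cong (λ e → ∑-δ (end e) (λ a → A e * u a)) ⟩
        A · (u ∘ end) ∎

    gap≈‖A-∇u‖² : ∀ {A u f} → (∀ a → div R src tgt A a ≈ f a) →
                  gap R src tgt A u f ≈ ∑ R (λ e → sq R (A e - grad R src tgt u e))
    gap≈‖A-∇u‖² {A} {u} {f} div≈f =
      trans (+-congˡ (-‿cong (+-congʳ (+-cong u·f≈A·∇u u·f≈A·∇u))))
            (·-square-expansion A (grad R src tgt u))
      where
      u·f≈A·∇u : u · f ≈ A · grad R src tgt u
      u·f≈A·∇u = trans (·-congˡ u (λ a → sym (div≈f a))) (summation-by-parts A u)

    module _ (A : Fin m → Carrier) where

      signedSum-++ : ∀ p q → signedSum R src tgt A (p ++ q) ≈
                             signedSum R src tgt A p + signedSum R src tgt A q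
      signedSum-++ [] q = sym (+-identityˡ _)
      signedSum-++ ((e , true) ∷ p) q = trans (+-congˡ (signedSum-++ p q)) (sym (+-assoc _ _ _))
      signedSum-++ ((e , false) ∷ p) q = trans (+-congˡ (signedSum-++ p q)) (sym (+-assoc _ _ _))

      ·-pathCoef : ∀ p → A · pathCoef R src tgt p ≈ signedSum R src tgt A p
      ·-pathCoef [] = ·-zeroʳ A
      ·-pathCoef ((e , true) ∷ p) =
        trans (·-distribˡ-+ A (δ R e) _) (+-cong (·-δ A e) (·-pathCoef p))
      ·-pathCoef ((e , false) ∷ p) =
        trans (·-distribˡ-+ A (λ e′ → - δ R e e′) _)
              (+-cong (trans (·-negʳ A (δ R e)) (-‿cong (·-δ A e))) (·-pathCoef p))

      signedSum-telescopes : ∀ {S u a b p} →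
                             (∀ e → S e ≡ true → grad R src tgt u e ≈ A e) →
                             Walk src tgt S a b p → signedSum R src tgt A p ≈ u b - u a
      signedSum-telescopes {u = u} {a} ∇u≈A nil = sym (-‿inverseʳ (u a))
      signedSum-telescopes {u = u} {b = b} ∇u≈A (fwd {e = e} {p} Se ≡.refl w) = begin
        A e + signedSum R src tgt A p
          ≈⟨ +-cong (sym (∇u≈A e Se)) (signedSum-telescopes ∇u≈A w) ⟩
        (u (tgt e) - u (src e)) + (u b - u (tgt e))
          ≈⟨ [y-x]+[z-y]≈z-x (u (src e)) (u (tgt e)) (u b) ⟩
        u b - u (src e) ∎
      signedSum-telescopes {u = u} {b = b} ∇u≈A (bwd {e = e} {p} Se ≡.refl w) = begin
        - A e + signedSum R src tgt A p
          ≈⟨ +-cong (-‿cong (sym (∇u≈A e Se))) (signedSum-telescopes ∇u≈A w) ⟩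
        - (u (tgt e) - u (src e)) + (u b - u (src e))
          ≈⟨ +-congʳ (⁻¹-anti-homo‿- (u (tgt e)) (u (src e))) ⟩
        (u (src e) - u (tgt e)) + (u b - u (src e))
          ≈⟨ [y-x]+[z-y]≈z-x (u (tgt e)) (u (src e)) (u b) ⟩
        u b - u (tgt e) ∎

    module _ (noLoops : NoLoops src tgt) {T : Fin m → Bool} (tree : SpanningTree src tgt T)
             {s : Fin n} {A : Fin m → Carrier} {u : Fin n → Carrier}
             (induced : InducedBy R src tgt T s A u) where

      grad-on-tree : ∀ e → T e ≡ true → grad R src tgt u e ≈ A e
      grad-on-tree e Te with proj₁ tree s (src e)
      ... | p , P with tree-path-across-edge noLoops tree Te P
      ... | inj₁ P+e = begin
        u (tgt e) - u (src e)
          ≈⟨ +-cong (induced _ _ P+e) (-‿cong (induced _ _ P)) ⟩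
        signedSum R src tgt A (p ++ (e , true) ∷ []) - signedSum R src tgt A p
          ≈⟨ +-congʳ (trans (signedSum-++ A p _) (+-congˡ (+-identityʳ (A e)))) ⟩
        (signedSum R src tgt A p + A e) - signedSum R src tgt A p
          ≈⟨ [x+y]-x≈y _ (A e) ⟩
        A e ∎
      ... | inj₂ (q , ≡.refl , Q) = begin
        u (tgt e) - u (src e)
          ≈⟨ +-cong (induced _ _ Q) (-‿cong (induced _ _ P)) ⟩
        signedSum R src tgt A q - signedSum R src tgt A (q ++ (e , false) ∷ [])
          ≈⟨ +-congˡ (-‿cong (trans (signedSum-++ A q _) (+-congˡ (+-identityʳ (- A e))))) ⟩
        signedSum R src tgt A q - (signedSum R src tgt A q - A e)
          ≈⟨ x-[x-y]≈y _ (A e) ⟩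
        A e ∎

      ·-treeCycle : ∀ {C} → TreeCycleFunctions R src tgt T C →
                    ∀ e → T e ≡ false → A · C e ≈ A e - grad R src tgt u e
      ·-treeCycle {C} cycles e Te with proj₁ tree (tgt e) (src e)
      ... | p , P@(w , _) = begin
        A · C e
          ≈⟨ ·-congˡ A (cycles e Te p P) ⟩
        A · (λ e′ → δ R e e′ + pathCoef R src tgt p e′)
          ≈⟨ ·-distribˡ-+ A (δ R e) _ ⟩
        A · δ R e + A · pathCoef R src tgt p
          ≈⟨ +-cong (·-δ A e) (·-pathCoef A p) ⟩
        A e + signedSum R src tgt A p
          ≈⟨ +-congˡ (signedSum-telescopes A {u = u} grad-on-tree w) ⟩
        A e + (u (src e) - u (tgt e))
          ≈⟨ +-congˡ (⁻¹-anti-homo‿- (u (tgt e)) (u (src e))) ⟨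
        A e - grad R src tgt u e ∎

      gap≈∑[A·C]² : ∀ {f C} → (∀ a → div R src tgt A a ≈ f a) →
                    TreeCycleFunctions R src tgt T C →
                    gap R src tgt A u f ≈ ∑ R (λ e → if T e then 0# else sq R (A · C e))
      gap≈∑[A·C]² {C = C} div≈f cycles = trans (gap≈‖A-∇u‖² div≈f) (∑-cong edgeTerm)
        where
        edgeTerm : ∀ e → sq R (A e - grad R src tgt u e) ≈
                         (if T e then 0# else sq R (A · C e))
        edgeTerm e with T e in Te
        ... | true = trans (*-cong vanishes vanishes) (zeroˡ 0#)
          where
          vanishes : A e - grad R src tgt u e ≈ 0#
          vanishes = trans (+-congˡ (-‿cong (grad-on-tree e Te))) (-‿inverseʳ (A e))
        ... | false = sym (*-cong (·-treeCycle cycles e Te) (·-treeCycle cycles e Te))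

lemma7 : ∀ {c ℓ} (R : CommutativeRing c ℓ) → let open CommutativeRing R in
    (n m : ℕ) (src tgt : Fin m → Fin n) →
    NoLoops src tgt → AtMostOneOrientation src tgt → Connected src tgt →
    (f : Fin n → Carrier) (A : Fin m → Carrier) →
    (∀ a → div R src tgt A a ≈ f a) →
    (T : Fin m → Bool) → SpanningTree src tgt T →
    (s : Fin n) → Leaf src tgt T s →
    (u : Fin n → Carrier) → InducedBy R src tgt T s A u →
    (C : Fin m → Fin m → Carrier) → TreeCycleFunctions R src tgt T C →
    gap R src tgt A u f ≈
      ∑ R (λ e → if T e then 0# else sq R (⟨_,_⟩ R A (C e)))
lemma7 R _ _ src tgt noLoops _ _ _ _ div≈f _ tree _ _ _ induced _ cycles =
  gap≈∑[A·C]² R src tgt noLoops tree induced div≈f cycles
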